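{- For every graph $G$ with $\chi_c^{\bullet}$-width $t$, we have $\chi_{c}^{\bullet}(G)\leq t+1$.
   Context: All graphs are finite and simple. A correspondence-cover of a graph $G$ is a pair $(L,H)$ where $H$ is a graph and $L:V(G)\to 2^{V(H)}$ satisfies: the sets $L(v)$ partition $V(H)$; each $L(v)$ induces a clique in $H$; if $uv\notin E(G)$ ($u\ne v$) there are no edges of $H$ between $L(u)$ and $L(v)$; if $uv\in E(G)$ the edges between $L(u)$ and $L(v)$ form a matching. It is $k$-fold if $|L(v)|=k$ for all $v$. An independent transversal is an independent set $I$ of $H$ with $|I\cap L(v)|=1$ for all $v$. The cover admits a fractional packing if there is a probability distribution on independent transversals $I$ with $\mathbb{P}(x\in I)\ge 1/|L(v)|$ for all $v$ and $x\in L(v)$. $\chi_c^{\bullet}(G)$ is the least integer $k$ such that every $k$-fold correspondence-cover of $G$ admits a fractional packing. The $\chi_c^{\bullet}$-width of $G$ is the minimum integer $t\ge 1$ such that there is a partition $V_1\cup\dots\cup V_m$ of $V(G)$ with $\chi_c^{\bullet}(G[V_i])\le t$ for all $1\le i\le m$, and such that for all $2\le i\le m$ every vertex of $V_i$ has at most one neighbour in $\bigcup_{j=1}^{i-1}V_j$.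
   Formalization: The probability distributions on independent transversals that define a fractional packing have rational weights. -}

module Defs where

open import Data.Bool using (Bool; true; false; if_then_else_)
open import Data.Nat using (ℕ; _<_; _≤_; suc)
open import Data.Fin using (Fin) renaming (_<_ to _<ᶠ_)
open import Data.Fin.Properties using (_≟_)
open import Data.Integer using (+_)
open import Data.Rational using (ℚ; 0ℚ; 1ℚ; _+_; _*_; _/_) renaming (_≤_ to _≤ℚ_)
open import Data.List using (List; []; _∷_)
open import Data.List.Relation.Unary.All using (All)
open import Data.Product using (Σ; _×_; _,_; proj₁; proj₂)
open import Relation.Nullary using (¬_)
open import Relation.Nullary.Decidable using (⌊_⌋)
open import Relation.Binary.PropositionalEquality using (_≡_)

record Graph (V : Set) : Set where
  field
    adj    : V → V → Bool
    sym    : ∀ u v → adj u v ≡ adj v u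
    irrefl : ∀ v → adj v v ≡ false
open Graph public

-- A k-fold correspondence-cover (L,H) of G, with L(v) = {v} × Fin k.
-- Each L(v) is a clique (implicit); M u v a b says (u,a)(v,b) ∈ E(H).
record Cover {V : Set} (G : Graph V) (k : ℕ) : Set where
  field
    M      : V → V → Fin k → Fin k → Bool
    edge   : ∀ u v a b → M u v a b ≡ true → adj G u v ≡ true
    symM   : ∀ u v a b → M u v a b ≡ M v u b a
    match₁ : ∀ u v a b c → M u v a b ≡ true → M u v a c ≡ true → b ≡ c
    match₂ : ∀ u v a b c → M u v a c ≡ true → M u v b c ≡ true → a ≡ b
open Cover public

IndepTransversal : {V : Set} {G : Graph V} {k : ℕ} → Cover G k → (V → Fin k) → Set
IndepTransversal C f = ∀ u v → M C u v (f u) (f v) ≡ false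

Dist : Set → ℕ → Set
Dist V k = List (ℚ × (V → Fin k))

totalWeight : {V : Set} {k : ℕ} → Dist V k → ℚ
totalWeight [] = 0ℚ
totalWeight ((w , _) ∷ D) = w + totalWeight D

-- P(x ∈ I) for x = (v, a)
mass : {V : Set} {k : ℕ} → Dist V k → V → Fin k → ℚ
mass [] v a = 0ℚ
mass ((w , f) ∷ D) v a = (if ⌊ f v ≟ a ⌋ then w else 0ℚ) + mass D v a

-- Fractional packing: probability distribution on independent transversals with
-- P(x ∈ I) ≥ 1/k for every x (written k · P(x ∈ I) ≥ 1).
FractionalPacking : {V : Set} {G : Graph V} {k : ℕ} → Cover G k → Set
FractionalPacking {V} {G} {k} C =
  Σ (Dist V k) λ D →
    All (λ p → (0ℚ ≤ℚ proj₁ p) × IndepTransversal C (proj₂ p)) D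
    × totalWeight D ≡ 1ℚ
    × (∀ v a → 1ℚ ≤ℚ ((+ k / 1) * mass D v a))

Good : {V : Set} → Graph V → ℕ → Set
Good G k = (C : Cover G k) → FractionalPacking C

IsChiFrac : {V : Set} → Graph V → ℕ → Set
IsChiFrac G k = Good G k × (∀ j → j < k → ¬ Good G j)

induced : {V : Set} → Graph V → (P : V → Set) → Graph (Σ V P)
induced G P = record
  { adj = λ u v → adj G (proj₁ u) (proj₁ v)
  ; sym = λ u v → sym G (proj₁ u) (proj₁ v)
  ; irrefl = λ v → irrefl G (proj₁ v) }

WidthPartition : {n : ℕ} → Graph (Fin n) → ℕ → Set
WidthPartition {n} G t =
  Σ ℕ λ m → Σ (Fin n → Fin m) λ part →
    (∀ i → Σ ℕ λ k → IsChiFrac (induced G (λ v → part v ≡ i)) k × k ≤ t)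
    × (∀ v u w → adj G v u ≡ true → adj G v w ≡ true →
         part u <ᶠ part v → part w <ᶠ part v → u ≡ w)

IsWidth : {n : ℕ} → Graph (Fin n) → ℕ → Set
IsWidth G t = 1 ≤ t × WidthPartition G t × (∀ s → 1 ≤ s → s < t → ¬ WidthPartition G s)

{-# OPTIONS --safe #-}
module Submission where

-- Colour the parts V₁, …, V_m one after another, keeping a probability distribution on colourings of
-- the parts done so far that are independent there and give every colour of every coloured vertex
-- probability at least 1/(t+1). For the next part, sample such a colouring f and a uniform colour s,
-- and delete one colour from each list L(v) of the part: if v has its (unique) earlier neighbour u,
-- the colour π(f u), where π is a permutation of the colours extending the matching between L(u)
-- and L(v); otherwise s. A fractional packing of the resulting t-fold cover of the part then extends
-- f, and the extension stays independent because the only colour of L(v) adjacent to f u is gone.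
-- Since every colour of u has probability exactly 1/(t+1), a colour a of v is deleted with
-- probability at most 1/(t+1) and is otherwise chosen with probability at least 1/t, hence overall
-- with probability at least (1 − 1/(t+1))/t = 1/(t+1). The same averaging with only the uniform
-- colour shows that χ_c^• is monotone, so the parts may be coloured from t colours.

open import Axiom.UniquenessOfIdentityProofs using (module Decidable⇒UIP)
open import Data.Bool using (Bool; true; false; if_then_else_)
import Data.Bool.Properties as Bool
open import Data.Fin using (Fin; zero; suc; toℕ; fromℕ<; punchIn; punchOut) renaming (_<_ to _<ᶠ_)
open import Data.Fin.Permutation using (Permutation′; _⟨$⟩ʳ_; _⟨$⟩ˡ_; inverseˡ; inverseʳ; insert; insert-punchIn)
import Data.Fin.Permutation as Permutation
open import Data.Fin.Properties using (_≟_; ¬Fin0; 0≢1+n; suc-injective; toℕ<n; toℕ-fromℕ<; toℕ-injective; any?; all?; ¬∀⟶∃¬; injective⇒≤; punchIn-injective; punchInᵢ≢i; punchIn-punchOut) renaming (_<?_ to _<ᶠ?_; <-irrefl to <ᶠ-irrefl)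
import Data.Integer as ℤ
open import Data.List using (List; []; _∷_; _++_; map)
open import Data.List.Relation.Unary.All as All using (All; []; _∷_)
open import Data.List.Relation.Unary.All.Properties using (++⁺; map⁺)
open import Data.Nat as ℕ using (ℕ; zero; suc)
import Data.Nat.Properties as ℕ
open import Data.Product using (Σ; ∃; _×_; _,_; proj₁; proj₂; map₁; map₂)
open import Data.Rational hiding (_≟_)
open import Data.Rational.Properties hiding (_≟_)
open import Data.Rational.Solver using (module +-*-Solver)
import Data.Rational.Unnormalised as ℚᵘ
import Data.Rational.Unnormalised.Properties as ℚᵘ
open import Data.Sum using (_⊎_; inj₁; inj₂)
open import Data.Unit using (⊤; tt)
open import Function using (_∘_; const)
open import Function.Definitions using (Injective)
open import Relation.Binary.PropositionalEquality
open import Relation.Nullary using (Dec; yes; no; does; ¬_; contradiction)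
open import Relation.Nullary.Decidable using (_×-dec_)

open import Defs hiding (sym)
open import Algebra.Properties.CommutativeMonoid.Sum +-0-commutativeMonoid using (sum; sum-remove; sum-replicate-zero)

private
  variable
    A B X : Set

fromℕ : ℕ → ℚ
fromℕ n = ℤ.+ n / 1

fromℕ-suc : ∀ n → fromℕ (suc n) ≡ 1ℚ + fromℕ n
fromℕ-suc n = toℚᵘ-injective (begin
  toℚᵘ (fromℕ (suc n))            ≈⟨ toℚᵘ-fromℚᵘ (ℚᵘ.mkℚᵘ (ℤ.+ suc n) 0) ⟩
  ℚᵘ.mkℚᵘ (ℤ.+ suc n) 0           ≈⟨ ℚᵘ.*≡* (cross-multiplied (ℤ.+ n)) ⟩
  ℚᵘ.1ℚᵘ ℚᵘ.+ ℚᵘ.mkℚᵘ (ℤ.+ n) 0   ≈⟨ ℚᵘ.+-congʳ ℚᵘ.1ℚᵘ (toℚᵘ-fromℚᵘ (ℚᵘ.mkℚᵘ (ℤ.+ n) 0)) ⟨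
  toℚᵘ 1ℚ ℚᵘ.+ toℚᵘ (fromℕ n)     ≈⟨ toℚᵘ-homo-+ 1ℚ (fromℕ n) ⟨
  toℚᵘ (1ℚ + fromℕ n)             ∎)
  where
  open import Relation.Binary.Reasoning.Setoid ℚᵘ.≃-setoid
  open import Data.Integer.Tactic.RingSolver using (solve-∀)
  cross-multiplied : ∀ i → (ℤ.1ℤ ℤ.+ i) ℤ.* (ℤ.1ℤ ℤ.* ℤ.1ℤ) ≡ (ℤ.1ℤ ℤ.* ℤ.1ℤ ℤ.+ i ℤ.* ℤ.1ℤ) ℤ.* ℤ.1ℤ
  cross-multiplied = solve-∀

fromℕ-nonNeg : ∀ n → NonNegative (fromℕ n)
fromℕ-nonNeg n = normalize-nonNeg n 1

fromℕ-suc-positive : ∀ n → Positive (fromℕ (suc n))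
fromℕ-suc-positive n = normalize-pos (suc n) 1

fromℕ-suc-nonZero : ∀ n → NonZero (fromℕ (suc n))
fromℕ-suc-nonZero n = pos⇒nonZero (fromℕ (suc n)) {{fromℕ-suc-positive n}}

1/suc_ : ℕ → ℚ
1/suc n = (1/ fromℕ (suc n)) {{fromℕ-suc-nonZero n}}

1/suc-nonNeg : ∀ n → 0ℚ ≤ 1/suc n
1/suc-nonNeg n = <⇒≤ (positive⁻¹ (1/suc n) {{1/pos⇒pos (fromℕ (suc n)) {{fromℕ-suc-positive n}}}})

1/suc-inverseʳ : ∀ n → fromℕ (suc n) * 1/suc n ≡ 1ℚ
1/suc-inverseʳ n = *-inverseʳ (fromℕ (suc n)) {{fromℕ-suc-nonZero n}}

1≤*⇒1/suc≤ : ∀ n {x} → 1ℚ ≤ fromℕ (suc n) * x → 1/suc n ≤ x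
1≤*⇒1/suc≤ n {x} 1≤nx = begin
  1/suc n                         ≡⟨ *-identityʳ (1/suc n) ⟨
  1/suc n * 1ℚ                    ≤⟨ *-monoˡ-≤-nonNeg (1/suc n) {{nonNegative (1/suc-nonNeg n)}} 1≤nx ⟩
  1/suc n * (fromℕ (suc n) * x)   ≡⟨ *-assoc (1/suc n) (fromℕ (suc n)) x ⟨
  (1/suc n * fromℕ (suc n)) * x   ≡⟨ cong (_* x) (*-inverseˡ (fromℕ (suc n)) {{fromℕ-suc-nonZero n}}) ⟩
  1ℚ * x                          ≡⟨ *-identityˡ x ⟩
  x                               ∎
  where open ≤-Reasoning

1/suc≤⇒1≤* : ∀ n {x} → 1/suc n ≤ x → 1ℚ ≤ fromℕ (suc n) * x
1/suc≤⇒1≤* n {x} 1/n≤x = begin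
  1ℚ                        ≡⟨ 1/suc-inverseʳ n ⟨
  fromℕ (suc n) * 1/suc n   ≤⟨ *-monoˡ-≤-nonNeg (fromℕ (suc n)) {{fromℕ-nonNeg (suc n)}} 1/n≤x ⟩
  fromℕ (suc n) * x         ∎
  where open ≤-Reasoning

1/suc+*1/suc≡1 : ∀ n → 1/suc n + fromℕ n * 1/suc n ≡ 1ℚ
1/suc+*1/suc≡1 n = begin
  1/suc n + fromℕ n * 1/suc n        ≡⟨ cong (_+ fromℕ n * 1/suc n) (*-identityˡ (1/suc n)) ⟨
  1ℚ * 1/suc n + fromℕ n * 1/suc n   ≡⟨ *-distribʳ-+ (1/suc n) 1ℚ (fromℕ n) ⟨
  (1ℚ + fromℕ n) * 1/suc n           ≡⟨ cong (_* 1/suc n) (fromℕ-suc n) ⟨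
  fromℕ (suc n) * 1/suc n            ≡⟨ 1/suc-inverseʳ n ⟩
  1ℚ                                 ∎
  where open ≡-Reasoning

1/suc-suc+*≡1/suc : ∀ n → 1/suc (suc n) + 1/suc n * 1/suc (suc n) ≡ 1/suc n
1/suc-suc+*≡1/suc n = begin
  r + q * r                         ≡⟨ cong (_+ q * r) (*-identityˡ r) ⟨
  1ℚ * r + q * r                    ≡⟨ cong (λ z → z * r + q * r) (1/suc-inverseʳ n) ⟨
  (fromℕ (suc n) * q) * r + q * r   ≡⟨ solve 3 (λ k q r → (k :* q) :* r :+ q :* r := q :* (r :+ k :* r)) refl (fromℕ (suc n)) q r ⟩
  q * (r + fromℕ (suc n) * r)       ≡⟨ cong (q *_) (1/suc+*1/suc≡1 (suc n)) ⟩
  q * 1ℚ                            ≡⟨ *-identityʳ q ⟩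
  q                                 ∎
  where
  open ≡-Reasoning
  open +-*-Solver
  q r : ℚ
  q = 1/suc n
  r = 1/suc (suc n)

+-cancelʳ-≤ : ∀ {x y} z → x + z ≤ y + z → x ≤ y
+-cancelʳ-≤ {x} {y} z x+z≤y+z = begin
  x           ≡⟨ solve 2 (λ x z → x := x :+ z :- z) refl x z ⟩
  x + z - z   ≤⟨ +-monoˡ-≤ (- z) x+z≤y+z ⟩
  y + z - z   ≡⟨ solve 2 (λ y z → y :+ z :- z := y) refl y z ⟩
  y           ∎
  where
  open ≤-Reasoning
  open +-*-Solver

0≤*0≤⇒0≤* : ∀ {p q} → 0ℚ ≤ p → 0ℚ ≤ q → 0ℚ ≤ p * q
0≤*0≤⇒0≤* {p} {q} 0≤p 0≤q = nonNegative⁻¹ (p * q) {{nonNeg*nonNeg⇒nonNeg p {{nonNegative 0≤p}} q {{nonNegative 0≤q}}}}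

𝟙 : {P : Set} → Dec P → ℚ
𝟙 d = if does d then 1ℚ else 0ℚ

𝟙-nonNeg : {P : Set} (d : Dec P) → 0ℚ ≤ 𝟙 d
𝟙-nonNeg (yes _) = nonNegative⁻¹ 1ℚ
𝟙-nonNeg (no _)  = ≤-refl

𝟙-cong : {P Q : Set} → (P → Q) → (Q → P) → (p : Dec P) (q : Dec Q) → 𝟙 p ≡ 𝟙 q
𝟙-cong P→Q Q→P (yes p) (yes q) = refl
𝟙-cong P→Q Q→P (yes p) (no ¬q) = contradiction (P→Q p) ¬q
𝟙-cong P→Q Q→P (no ¬p) (yes q) = contradiction (Q→P q) ¬p
𝟙-cong P→Q Q→P (no ¬p) (no ¬q) = refl

sum-mono-≤ : ∀ {n} {f g : Fin n → ℚ} → (∀ i → f i ≤ g i) → sum f ≤ sum g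
sum-mono-≤ {zero}  f≤g = ≤-refl
sum-mono-≤ {suc n} f≤g = +-mono-≤ (f≤g zero) (sum-mono-≤ (f≤g ∘ suc))

sum-const : ∀ n x → sum {n} (const x) ≡ fromℕ n * x
sum-const zero    x = sym (*-zeroˡ x)
sum-const (suc n) x = begin
  x + sum {n} (const x)   ≡⟨ cong₂ _+_ (*-identityˡ x) (sym (sum-const n x)) ⟨
  1ℚ * x + fromℕ n * x    ≡⟨ *-distribʳ-+ x 1ℚ (fromℕ n) ⟨
  (1ℚ + fromℕ n) * x      ≡⟨ cong (_* x) (fromℕ-suc n) ⟨
  fromℕ (suc n) * x       ∎
  where open ≡-Reasoning

sum-𝟙-≟ˡ : ∀ {n} (a : Fin n) → sum (λ c → 𝟙 (c ≟ a)) ≡ 1ℚ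
sum-𝟙-≟ˡ {suc n} zero    = trans (cong (1ℚ +_) (sum-replicate-zero n)) (+-identityʳ 1ℚ)
sum-𝟙-≟ˡ {suc n} (suc a) = trans (+-identityˡ _) (sum-𝟙-≟ˡ a)

sum-𝟙-≟ʳ : ∀ {n} (a : Fin n) → sum (λ c → 𝟙 (a ≟ c)) ≡ 1ℚ
sum-𝟙-≟ʳ {suc n} zero    = trans (cong (1ℚ +_) (sum-replicate-zero n)) (+-identityʳ 1ℚ)
sum-𝟙-≟ʳ {suc n} (suc a) = trans (+-identityˡ _) (sum-𝟙-≟ʳ a)

sum≡1⇒≤1/suc : ∀ {n} (m : Fin (suc n) → ℚ) → sum m ≡ 1ℚ → (∀ c → 1/suc n ≤ m c) → ∀ c → m c ≤ 1/suc n
sum≡1⇒≤1/suc {n} m sum≡1 1/suc≤m c = +-cancelʳ-≤ (fromℕ n * 1/suc n) (begin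
  m c + fromℕ n * 1/suc n           ≡⟨ cong (m c +_) (sum-const n (1/suc n)) ⟨
  m c + sum {n} (const (1/suc n))   ≤⟨ +-monoʳ-≤ (m c) (sum-mono-≤ (1/suc≤m ∘ punchIn c)) ⟩
  m c + sum (m ∘ punchIn c)         ≡⟨ sum-remove m ⟨
  sum m                             ≡⟨ sum≡1 ⟩
  1ℚ                                ≡⟨ 1/suc+*1/suc≡1 n ⟨
  1/suc n + fromℕ n * 1/suc n       ∎)
  where open ≤-Reasoning

Weighted : Set → Set
Weighted A = List (ℚ × A)

expect : Weighted A → (A → ℚ) → ℚ
expect []            φ = 0ℚ
expect ((w , x) ∷ D) φ = w * φ x + expect D φ

prob : {P : A → Set} → Weighted A → (∀ x → Dec (P x)) → ℚ
prob D P? = expect D (λ x → 𝟙 (P? x))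

scale : ℚ → Weighted A → Weighted A
scale w = map (map₁ (w *_))

bind : Weighted A → (A → Weighted B) → Weighted B
bind []            k = []
bind ((w , x) ∷ D) k = scale w (k x) ++ bind D k

push : (A → B) → Weighted A → Weighted B
push h = map (map₂ h)

_⊗_ : Weighted A → Weighted B → Weighted (A × B)
D ⊗ E = bind D (λ x → push (x ,_) E)

uniform : (n : ℕ) → ℚ → Weighted (Fin n)
uniform zero    w = []
uniform (suc n) w = (w , zero) ∷ push suc (uniform n w)

expect-cong : ∀ (D : Weighted A) {φ ψ} → (∀ x → φ x ≡ ψ x) → expect D φ ≡ expect D ψ
expect-cong []            φ≡ψ = refl
expect-cong ((w , x) ∷ D) φ≡ψ = cong₂ _+_ (cong (w *_) (φ≡ψ x)) (expect-cong D φ≡ψ)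

expect-+ : ∀ (D : Weighted A) φ ψ → expect D (λ x → φ x + ψ x) ≡ expect D φ + expect D ψ
expect-+ []            φ ψ = sym (+-identityˡ 0ℚ)
expect-+ ((w , x) ∷ D) φ ψ = trans (cong (w * (φ x + ψ x) +_) (expect-+ D φ ψ))
  (solve 5 (λ w a b A B → w :* (a :+ b) :+ (A :+ B) := (w :* a :+ A) :+ (w :* b :+ B)) refl
    w (φ x) (ψ x) (expect D φ) (expect D ψ))
  where open +-*-Solver

expect-*ˡ : ∀ (D : Weighted A) c φ → expect D (λ x → c * φ x) ≡ c * expect D φ
expect-*ˡ []            c φ = sym (*-zeroʳ c)
expect-*ˡ ((w , x) ∷ D) c φ = trans (cong (w * (c * φ x) +_) (expect-*ˡ D c φ))
  (solve 4 (λ w c a A → w :* (c :* a) :+ c :* A := c :* (w :* a :+ A)) refl w c (φ x) (expect D φ))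
  where open +-*-Solver

expect-0 : ∀ (D : Weighted A) → expect D (const 0ℚ) ≡ 0ℚ
expect-0 []            = refl
expect-0 ((w , _) ∷ D) = trans (cong₂ _+_ (*-zeroʳ w) (expect-0 D)) (+-identityʳ 0ℚ)

expect-++ : ∀ (D E : Weighted A) φ → expect (D ++ E) φ ≡ expect D φ + expect E φ
expect-++ []            E φ = sym (+-identityˡ _)
expect-++ ((w , x) ∷ D) E φ =
  trans (cong (w * φ x +_) (expect-++ D E φ)) (sym (+-assoc (w * φ x) (expect D φ) (expect E φ)))

expect-scale : ∀ w (D : Weighted A) φ → expect (scale w D) φ ≡ w * expect D φ
expect-scale w []             φ = sym (*-zeroʳ w)
expect-scale w ((w′ , x) ∷ D) φ = trans (cong₂ _+_ (*-assoc w w′ (φ x)) (expect-scale w D φ))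
  (sym (*-distribˡ-+ w _ _))

expect-bind : ∀ (D : Weighted A) (k : A → Weighted B) φ → expect (bind D k) φ ≡ expect D (λ x → expect (k x) φ)
expect-bind []            k φ = refl
expect-bind ((w , x) ∷ D) k φ =
  trans (expect-++ (scale w (k x)) (bind D k) φ) (cong₂ _+_ (expect-scale w (k x) φ) (expect-bind D k φ))

expect-push : ∀ (h : A → B) (D : Weighted A) φ → expect (push h D) φ ≡ expect D (φ ∘ h)
expect-push h []            φ = refl
expect-push h ((w , x) ∷ D) φ = cong (w * φ (h x) +_) (expect-push h D φ)

expect-⊗ : ∀ (D : Weighted A) (E : Weighted B) φ → expect (D ⊗ E) φ ≡ expect D (λ x → expect E (λ y → φ (x , y)))
expect-⊗ D E φ = trans (expect-bind D _ φ) (expect-cong D (λ x → expect-push (x ,_) E φ))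

expect-uniform : ∀ n w (φ : Fin n → ℚ) → expect (uniform n w) φ ≡ w * sum φ
expect-uniform zero    w φ = sym (*-zeroʳ w)
expect-uniform (suc n) w φ = begin
  w * φ zero + expect (push suc (uniform n w)) φ   ≡⟨ cong (w * φ zero +_) (expect-push suc (uniform n w) φ) ⟩
  w * φ zero + expect (uniform n w) (φ ∘ suc)      ≡⟨ cong (w * φ zero +_) (expect-uniform n w (φ ∘ suc)) ⟩
  w * φ zero + w * sum (φ ∘ suc)                   ≡⟨ *-distribˡ-+ w _ _ ⟨
  w * sum φ                                        ∎
  where open ≡-Reasoning

sum-expect : ∀ n (D : Weighted A) (φ : Fin n → A → ℚ) → sum (λ c → expect D (φ c)) ≡ expect D (λ x → sum (λ c → φ c x))
sum-expect zero    D φ = sym (expect-0 D)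
sum-expect (suc n) D φ = trans (cong (expect D (φ zero) +_) (sum-expect n D (φ ∘ suc))) (sym (expect-+ D _ _))

NonNegWeights : Weighted A → Set
NonNegWeights = All (λ e → 0ℚ ≤ proj₁ e)

expect-mono : ∀ {D : Weighted A} {φ ψ} → NonNegWeights D → (∀ x → φ x ≤ ψ x) → expect D φ ≤ expect D ψ
expect-mono []           φ≤ψ = ≤-refl
expect-mono {D = (w , x) ∷ D} (0≤w ∷ 0≤D) φ≤ψ = +-mono-≤ (*-monoˡ-≤-nonNeg w {{nonNegative 0≤w}} (φ≤ψ x)) (expect-mono 0≤D φ≤ψ)

expect-nonNeg : ∀ {D : Weighted A} {φ} → NonNegWeights D → (∀ x → 0ℚ ≤ φ x) → 0ℚ ≤ expect D φ
expect-nonNeg {D = D} 0≤D 0≤φ = ≤-trans (≤-reflexive (sym (expect-0 D))) (expect-mono 0≤D 0≤φ)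

record IsProbability (D : Weighted A) : Set where
  field
    nonNegWeights : NonNegWeights D
    total         : expect D (const 1ℚ) ≡ 1ℚ
open IsProbability

expect-const : ∀ {D : Weighted A} → IsProbability D → ∀ c → expect D (const c) ≡ c
expect-const {D = D} p c = begin
  expect D (const c)        ≡⟨ expect-cong D (λ _ → *-identityʳ c) ⟨
  expect D (λ _ → c * 1ℚ)   ≡⟨ expect-*ˡ D c (const 1ℚ) ⟩
  c * expect D (const 1ℚ)   ≡⟨ cong (c *_) (total p) ⟩
  c * 1ℚ                    ≡⟨ *-identityʳ c ⟩
  c                         ∎
  where open ≡-Reasoning

bind-isProbability : ∀ {D : Weighted A} {k : A → Weighted B} → IsProbability D → (∀ x → IsProbability (k x)) → IsProbability (bind D k)
bind-isProbability {D = D} {k} pD pk = record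
  { nonNegWeights = nonNeg-bind D (nonNegWeights pD)
  ; total         = trans (expect-bind D k (const 1ℚ)) (trans (expect-cong D (total ∘ pk)) (total pD))
  }
  where
  nonNeg-bind : ∀ D → NonNegWeights D → NonNegWeights (bind D k)
  nonNeg-bind []            []          = []
  nonNeg-bind ((w , x) ∷ D) (0≤w ∷ 0≤D) = ++⁺ (map⁺ (All.map (0≤*0≤⇒0≤* 0≤w) (nonNegWeights (pk x)))) (nonNeg-bind D 0≤D)

push-isProbability : ∀ (h : A → B) {D} → IsProbability D → IsProbability (push h D)
push-isProbability h {D} pD = record
  { nonNegWeights = map⁺ (nonNegWeights pD)
  ; total         = trans (expect-push h D (const 1ℚ)) (total pD)
  }

⊗-isProbability : ∀ {D : Weighted A} {E : Weighted B} → IsProbability D → IsProbability E → IsProbability (D ⊗ E)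
⊗-isProbability pD pE = bind-isProbability pD (λ x → push-isProbability (x ,_) pE)

uniform-isProbability : ∀ n → IsProbability (uniform (suc n) (1/suc n))
uniform-isProbability n = record
  { nonNegWeights = nonNeg-uniform (suc n)
  ; total         = begin
      expect (uniform (suc n) (1/suc n)) (const 1ℚ)   ≡⟨ expect-uniform (suc n) (1/suc n) (const 1ℚ) ⟩
      1/suc n * sum {suc n} (const 1ℚ)                ≡⟨ cong (1/suc n *_) (sum-const (suc n) 1ℚ) ⟩
      1/suc n * (fromℕ (suc n) * 1ℚ)                  ≡⟨ cong (1/suc n *_) (*-identityʳ (fromℕ (suc n))) ⟩
      1/suc n * fromℕ (suc n)                         ≡⟨ *-comm (1/suc n) (fromℕ (suc n)) ⟩
      fromℕ (suc n) * 1/suc n                         ≡⟨ 1/suc-inverseʳ n ⟩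
      1ℚ                                              ∎
  }
  where
  open ≡-Reasoning
  nonNeg-uniform : ∀ m → NonNegWeights (uniform m (1/suc n))
  nonNeg-uniform zero    = []
  nonNeg-uniform (suc m) = 1/suc-nonNeg n ∷ map⁺ (nonNeg-uniform m)

prob-uniform : ∀ n (a : Fin (suc n)) → prob (uniform (suc n) (1/suc n)) (_≟ a) ≡ 1/suc n
prob-uniform n a = trans (expect-uniform (suc n) (1/suc n) (λ c → 𝟙 (c ≟ a)))
  (trans (cong (1/suc n *_) (sum-𝟙-≟ˡ a)) (*-identityʳ (1/suc n)))

All-bind : ∀ {P : B → Set} {Q : A → Set} {D : Weighted A} {k : A → Weighted B} →
           (∀ {x} → Q x → All (P ∘ proj₂) (k x)) → All (Q ∘ proj₂) D → All (P ∘ proj₂) (bind D k)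
All-bind Q⇒P []       = []
All-bind Q⇒P (q ∷ qs) = ++⁺ (map⁺ (Q⇒P q)) (All-bind Q⇒P qs)

All-push : ∀ {P : B → Set} {Q : A → Set} {h : A → B} {D : Weighted A} →
           (∀ {x} → Q x → P (h x)) → All (Q ∘ proj₂) D → All (P ∘ proj₂) (push h D)
All-push Q⇒P qs = map⁺ (All.map Q⇒P qs)

All-⊗ : ∀ {Q : A → Set} {D : Weighted A} (E : Weighted B) → All (Q ∘ proj₂) D → All (Q ∘ proj₁ ∘ proj₂) (D ⊗ E)
All-⊗ E = All-bind (λ q → All-push (λ _ → q) (All.universal (λ _ → tt) E))

prob≤1/suc : ∀ {D : Weighted A} {n} → IsProbability D → (col : A → Fin (suc n)) →
               (∀ c → 1/suc n ≤ prob D (λ x → col x ≟ c)) → ∀ c → prob D (λ x → col x ≟ c) ≤ 1/suc n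
prob≤1/suc {D = D} {n} pD col = sum≡1⇒≤1/suc (λ c → prob D (λ x → col x ≟ c)) (begin
  sum (λ c → prob D (λ x → col x ≟ c))         ≡⟨ sum-expect (suc n) D (λ c x → 𝟙 (col x ≟ c)) ⟩
  expect D (λ x → sum (λ c → 𝟙 (col x ≟ c)))   ≡⟨ expect-cong D (sum-𝟙-≟ʳ ∘ col) ⟩
  expect D (const 1ℚ)                          ≡⟨ total pD ⟩
  1ℚ                                           ∎)
  where open ≡-Reasoning

-- With q = 1/(n+1) and r = 1/(n+2): pointwise q ≤ m + q·[c = a], so q ≤ 𝔼 m + q·r, and q = r + q·r.
1/suc≤expect-if-rarely-forbidden :
  ∀ {Ω : Weighted X} {n} → IsProbability Ω → (c : X → Fin (suc (suc n))) (a : Fin (suc (suc n))) (m : X → ℚ) →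
  (∀ x → 0ℚ ≤ m x) → (∀ x → c x ≢ a → 1/suc n ≤ m x) → prob Ω (λ x → c x ≟ a) ≤ 1/suc (suc n) →
  1/suc (suc n) ≤ expect Ω m
1/suc≤expect-if-rarely-forbidden {Ω = Ω} {n} pΩ c a m 0≤m q≤m P≤r = +-cancelʳ-≤ (q * r) (begin
  r + q * r                                       ≡⟨ 1/suc-suc+*≡1/suc n ⟩
  q                                               ≡⟨ expect-const pΩ q ⟨
  expect Ω (const q)                              ≤⟨ expect-mono (nonNegWeights pΩ) q≤m+q𝟙 ⟩
  expect Ω (λ x → m x + q * 𝟙 (c x ≟ a))          ≡⟨ expect-+ Ω m _ ⟩
  expect Ω m + expect Ω (λ x → q * 𝟙 (c x ≟ a))   ≡⟨ cong (expect Ω m +_) (expect-*ˡ Ω q _) ⟩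
  expect Ω m + q * prob Ω (λ x → c x ≟ a)         ≤⟨ +-monoʳ-≤ (expect Ω m) (*-monoˡ-≤-nonNeg q {{nonNegative (1/suc-nonNeg n)}} P≤r) ⟩
  expect Ω m + q * r                              ∎)
  where
  open ≤-Reasoning
  q r : ℚ
  q = 1/suc n
  r = 1/suc (suc n)
  q≤m+q𝟙 : ∀ x → q ≤ m x + q * 𝟙 (c x ≟ a)
  q≤m+q𝟙 x with c x ≟ a
  ... | yes _    = begin
    q              ≡⟨ trans (+-identityˡ (q * 1ℚ)) (*-identityʳ q) ⟨
    0ℚ + q * 1ℚ    ≤⟨ +-monoˡ-≤ (q * 1ℚ) (0≤m x) ⟩
    m x + q * 1ℚ   ∎
  ... | no  cx≢a = begin
    q              ≤⟨ q≤m x cx≢a ⟩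
    m x            ≡⟨ +-identityʳ (m x) ⟨
    m x + 0ℚ       ≡⟨ cong (m x +_) (*-zeroʳ q) ⟨
    m x + q * 0ℚ   ∎

record IsMatching {n} (R : Fin n → Fin n → Bool) : Set where
  field
    functional : ∀ a b c → R a b ≡ true → R a c ≡ true → b ≡ c
    injective  : ∀ a b c → R a c ≡ true → R b c ≡ true → a ≡ b
open IsMatching

Extends : ∀ {n} → Permutation′ n → (Fin n → Fin n → Bool) → Set
Extends π R = ∀ {a b} → R a b ≡ true → π ⟨$⟩ʳ a ≡ b

free-column : ∀ {n} (R : Fin n → Fin (suc n) → Bool) →
              (∀ c a b → R c a ≡ true → R c b ≡ true → a ≡ b) → ∃ λ b → ∀ c → R c b ≡ false
free-column {n} R functional with any? (λ b → all? (λ c → R c b Bool.≟ false))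
... | yes free  = free
... | no ¬free = contradiction (injective⇒≤ {f = proj₁ ∘ row} row-injective) ℕ.1+n≰n
  where
  row : ∀ b → ∃ λ c → R c b ≡ true
  row b = map₂ Bool.¬-not (¬∀⟶∃¬ n _ (λ c → R c b Bool.≟ false) (¬free ∘ (b ,_)))
  row-injective : Injective _≡_ _≡_ (proj₁ ∘ row)
  row-injective {a} {b} same = functional _ a b (proj₂ (row a)) (subst (λ c → R c b ≡ true) (sym same) (proj₂ (row b)))

pivot : ∀ {n} {R : Fin (suc n) → Fin (suc n) → Bool} → IsMatching R →
        ∃ λ b₀ → (∀ {b} → R zero b ≡ true → b ≡ b₀) × (∀ c → R (suc c) b₀ ≡ false)
pivot {R = R} matching with any? (λ b → R zero b Bool.≟ true)
... | yes (b₀ , R0b₀) = b₀ , (λ R0b → functional matching _ _ _ R0b R0b₀) , (λ c → Bool.¬-not (0≢1+n ∘ injective matching _ _ _ R0b₀))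
... | no ¬R0b         = map₂ ((λ R0b → contradiction (_ , R0b) ¬R0b) ,_) (free-column (R ∘ suc) (functional matching ∘ suc))

matching⇒permutation : ∀ {n} {R : Fin n → Fin n → Bool} → IsMatching R → Σ (Permutation′ n) (λ π → Extends π R)
matching⇒permutation {zero}          _        = Permutation.id , λ { {()} }
matching⇒permutation {suc n} {R = R} matching with pivot matching
... | b₀ , row₀ , col₀ = insert zero b₀ π′ , extends
  where
  matching′ : IsMatching (λ c b → R (suc c) (punchIn b₀ b))
  matching′ = record
    { functional = λ a b c Rab Rac → punchIn-injective b₀ b c (functional matching _ _ _ Rab Rac)
    ; injective  = λ a b c Rac Rbc → suc-injective (injective matching _ _ _ Rac Rbc)
    }
  π′ : Permutation′ n
  π′ = proj₁ (matching⇒permutation matching′)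
  extends : Extends (insert zero b₀ π′) R
  extends {zero}  R0b = sym (row₀ R0b)
  extends {suc c} {b} Rcb = begin
    insert zero b₀ π′ ⟨$⟩ʳ suc c   ≡⟨ insert-punchIn zero b₀ π′ c ⟩
    punchIn b₀ (π′ ⟨$⟩ʳ c)         ≡⟨ cong (punchIn b₀) (proj₂ (matching⇒permutation matching′) Rcb′) ⟩
    punchIn b₀ (punchOut b₀≢b)     ≡⟨ punchIn-punchOut b₀≢b ⟩
    b                              ∎
    where
    open ≡-Reasoning
    b₀≢b : b₀ ≢ b
    b₀≢b refl = Bool.not-¬ (col₀ c) Rcb
    Rcb′ : R (suc c) (punchIn b₀ (punchOut b₀≢b)) ≡ true
    Rcb′ = subst (λ z → R (suc c) z ≡ true) (sym (punchIn-punchOut b₀≢b)) Rcb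

𝟙-⟨$⟩ʳ-≟ : ∀ {n} (ρ : Permutation′ n) x a → 𝟙 (ρ ⟨$⟩ʳ x ≟ a) ≡ 𝟙 (x ≟ ρ ⟨$⟩ˡ a)
𝟙-⟨$⟩ʳ-≟ ρ x a = 𝟙-cong (λ { refl → sym (inverseˡ ρ) }) (λ { refl → inverseʳ ρ }) (ρ ⟨$⟩ʳ x ≟ a) (x ≟ ρ ⟨$⟩ˡ a)

lift : ∀ {k} → (A → Fin (suc k)) → (A → Fin k) → A → Fin (suc k)
lift φ g v = punchIn (φ v) (g v)

Avoids : ∀ {k} → (A → Fin k) → (A → Fin k) → Set
Avoids φ f = ∀ v → f v ≢ φ v

module _ {V : Set} {G : Graph V} where

  restrict : ∀ {k} → Cover G k → (P : V → Set) → Cover (induced G P) k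
  restrict C P = record
    { M      = λ x y → M C (proj₁ x) (proj₁ y)
    ; edge   = λ x y → edge C (proj₁ x) (proj₁ y)
    ; symM   = λ x y → symM C (proj₁ x) (proj₁ y)
    ; match₁ = λ x y → match₁ C (proj₁ x) (proj₁ y)
    ; match₂ = λ x y → match₂ C (proj₁ x) (proj₁ y)
    }

  _∖_ : ∀ {k} → Cover G (suc k) → (V → Fin (suc k)) → Cover G k
  C ∖ φ = record
    { M      = λ x y a b → M C x y (punchIn (φ x) a) (punchIn (φ y) b)
    ; edge   = λ x y a b → edge C x y _ _
    ; symM   = λ x y a b → symM C x y _ _
    ; match₁ = λ x y a b c Mab Mac → punchIn-injective (φ y) b c (match₁ C x y _ _ _ Mab Mac)
    ; match₂ = λ x y a b c Mac Mbc → punchIn-injective (φ x) a b (match₂ C x y _ _ _ Mac Mbc)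
    }

  IndependentOn : ∀ {k} → Cover G k → (V → Set) → (V → Fin k) → Set
  IndependentOn C S f = ∀ u v → S u → S v → M C u v (f u) (f v) ≡ false

  record PartialPacking {k} (C : Cover G (suc k)) (S : V → Set) : Set where
    field
      dist          : Weighted (V → Fin (suc k))
      isProbability : IsProbability dist
      independent   : All (IndependentOn C S ∘ proj₂) dist
      covers        : ∀ v a → S v → 1/suc k ≤ prob dist (λ f → f v ≟ a)

  record AvoidingPacking {k} (C : Cover G (suc (suc k))) (φ : V → Fin (suc (suc k))) : Set where
    field
      dist          : Weighted (V → Fin (suc (suc k)))
      isProbability : IsProbability dist
      admissible    : All (λ e → IndepTransversal C (proj₂ e) × Avoids φ (proj₂ e)) dist
      covers        : ∀ v a → φ v ≢ a → 1/suc k ≤ prob dist (λ f → f v ≟ a)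

  totalWeight≡expect : ∀ {k} (D : Dist V k) → totalWeight D ≡ expect D (const 1ℚ)
  totalWeight≡expect []            = refl
  totalWeight≡expect ((w , f) ∷ D) = cong₂ _+_ (sym (*-identityʳ w)) (totalWeight≡expect D)

  mass≡prob : ∀ {k} (D : Dist V k) v a → mass D v a ≡ prob D (λ f → f v ≟ a)
  mass≡prob []            v a = refl
  mass≡prob ((w , f) ∷ D) v a with f v ≟ a
  ... | yes _ = cong₂ _+_ (sym (*-identityʳ w)) (mass≡prob D v a)
  ... | no  _ = cong₂ _+_ (sym (*-zeroʳ w)) (mass≡prob D v a)

  fromFractionalPacking : ∀ {k} {C : Cover G (suc k)} → FractionalPacking C → PartialPacking C (const ⊤)
  fromFractionalPacking {k} (D , admissible , total≡1 , covers) = record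
    { dist          = D
    ; isProbability = record
      { nonNegWeights = All.map proj₁ admissible
      ; total         = trans (sym (totalWeight≡expect D)) total≡1
      }
    ; independent   = All.map (λ e u v _ _ → proj₂ e u v) admissible
    ; covers        = λ v a _ → 1≤*⇒1/suc≤ k (subst (λ p → 1ℚ ≤ fromℕ (suc k) * p) (mass≡prob D v a) (covers v a))
    }

  toFractionalPacking : ∀ {k} {C : Cover G (suc k)} {S} → PartialPacking C S → (∀ v → S v) → FractionalPacking C
  toFractionalPacking {k} P everywhere =
    dist ,
    All.zipWith (λ (0≤w , ind) → 0≤w , λ u v → ind u v (everywhere u) (everywhere v)) (nonNegWeights isProbability , independent) ,
    trans (totalWeight≡expect dist) (total isProbability) ,
    λ v a → subst (λ p → 1ℚ ≤ fromℕ (suc k) * p) (sym (mass≡prob dist v a)) (1/suc≤⇒1≤* k (covers v a (everywhere v)))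
    where open PartialPacking P

  avoidingPacking : ∀ {k} → Good G (suc k) → (C : Cover G (suc (suc k))) (φ : V → Fin (suc (suc k))) → AvoidingPacking C φ
  avoidingPacking {k} good C φ = record
    { dist          = push (lift φ) P.dist
    ; isProbability = push-isProbability (lift φ) P.isProbability
    ; admissible    = All-push (λ ind → (λ u v → ind u v tt tt) , (λ v → punchInᵢ≢i (φ v) _)) P.independent
    ; covers        = covers
    }
    where
    module P = PartialPacking (fromFractionalPacking {C = C ∖ φ} (good (C ∖ φ)))
    covers : ∀ v a → φ v ≢ a → 1/suc k ≤ prob (push (lift φ) P.dist) (λ f → f v ≟ a)
    covers v a φv≢a = begin
      1/suc k                                       ≤⟨ P.covers v (punchOut φv≢a) tt ⟩
      prob P.dist (λ g → g v ≟ punchOut φv≢a)       ≡⟨ expect-cong P.dist (λ g → 𝟙-cong lifted (unlifted g) (g v ≟ punchOut φv≢a) (lift φ g v ≟ a)) ⟩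
      expect P.dist (λ g → 𝟙 (lift φ g v ≟ a))      ≡⟨ expect-push (lift φ) P.dist _ ⟨
      prob (push (lift φ) P.dist) (λ f → f v ≟ a)   ∎
      where
      open ≤-Reasoning
      lifted : ∀ {c} → c ≡ punchOut φv≢a → punchIn (φ v) c ≡ a
      lifted refl = punchIn-punchOut φv≢a
      unlifted : ∀ g → punchIn (φ v) (g v) ≡ a → g v ≡ punchOut φv≢a
      unlifted g e = punchIn-injective (φ v) _ _ (trans e (sym (punchIn-punchOut φv≢a)))

  zeroFoldCover : Cover G 0
  zeroFoldCover = record { M = λ _ _ (); edge = λ _ _ (); symM = λ _ _ (); match₁ = λ _ _ (); match₂ = λ _ _ () }

  Good-zero⇒empty : Good G 0 → ¬ V
  Good-zero⇒empty good v with good zeroFoldCover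
  ... | []          , _ , () , _
  ... | (_ , f) ∷ _ , _ = ¬Fin0 (f v)

  Good-of-empty : ¬ V → ∀ k → Good G k
  Good-of-empty ¬v k C =
    (1ℚ , λ v → contradiction v ¬v) ∷ [] ,
    (nonNegative⁻¹ 1ℚ , λ u → contradiction u ¬v) ∷ [] ,
    +-identityʳ 1ℚ ,
    λ v → contradiction v ¬v

  mixture-covers : ∀ {k} {C : Cover G (suc (suc k))} {Ω : Weighted X} {φ : X → V → Fin (suc (suc k))} →
                   IsProbability Ω → (E : ∀ x → AvoidingPacking C (φ x)) → ∀ v a →
                   prob Ω (λ x → φ x v ≟ a) ≤ 1/suc (suc k) →
                   1/suc (suc k) ≤ expect Ω (λ x → prob (AvoidingPacking.dist (E x)) (λ f → f v ≟ a))
  mixture-covers {φ = φ} pΩ E v a rarely-forbidden =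
    1/suc≤expect-if-rarely-forbidden pΩ (λ x → φ x v) a _
      (λ x → expect-nonNeg (nonNegWeights (E.isProbability x)) (λ f → 𝟙-nonNeg (f v ≟ a)))
      (λ x → E.covers x v a)
      rarely-forbidden
    where module E x = AvoidingPacking (E x)

  Good-suc : ∀ {k} → Good G k → Good G (suc k)
  Good-suc {zero}  good   = Good-of-empty (Good-zero⇒empty good) 1
  Good-suc {suc k} good C = toFractionalPacking packing (λ _ → tt)
    where
    U : Weighted (Fin (suc (suc k)))
    U = uniform (suc (suc k)) (1/suc (suc k))
    avoiding : ∀ s → AvoidingPacking C (const s)
    avoiding s = avoidingPacking good C (const s)
    module E s = AvoidingPacking (avoiding s)
    packing : PartialPacking C (const ⊤)
    packing = record
      { dist          = bind U E.dist
      ; isProbability = bind-isProbability (uniform-isProbability (suc k)) E.isProbability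
      ; independent   = All-bind (λ {s} _ → All.map (λ e u v _ _ → proj₁ e u v) (E.admissible s)) (All.universal (λ _ → tt) U)
      ; covers        = λ v a _ → subst (1/suc (suc k) ≤_) (sym (expect-bind U E.dist _))
                          (mixture-covers (uniform-isProbability (suc k)) avoiding v a (≤-reflexive (prob-uniform (suc k) a)))
      }

  Good-mono : ∀ {j k} → j ℕ.≤ k → Good G j → Good G k
  Good-mono j≤k = go (ℕ.≤⇒≤′ j≤k)
    where
    go : ∀ {j k} → j ℕ.≤′ k → Good G j → Good G k
    go ℕ.≤′-refl      good = good
    go (ℕ.≤′-step j≤k) good = Good-suc (go j≤k good)

module Layered {n m} (G : Graph (Fin n)) (part : Fin n → Fin m)
  (one-earlier : ∀ v u w → adj G v u ≡ true → adj G v w ≡ true → part u <ᶠ part v → part w <ᶠ part v → u ≡ w)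
  {k} (good : ∀ j → Good (induced G (λ v → part v ≡ j)) (suc k))
  (C : Cover G (suc (suc k))) where

  K : ℕ
  K = suc (suc k)

  r : ℚ
  r = 1/suc (suc k)

  U : Weighted (Fin K)
  U = uniform K r

  pU : IsProbability U
  pU = uniform-isProbability (suc k)

  Below : ℕ → Fin n → Set
  Below i v = toℕ (part v) ℕ.< i

  EarlierNeighbour : Fin n → Set
  EarlierNeighbour v = ∃ λ u → adj G v u ≡ true × part u <ᶠ part v

  earlierNeighbour? : ∀ v → Dec (EarlierNeighbour v)
  earlierNeighbour? v = any? (λ u → (adj G v u Bool.≟ true) ×-dec (part u <ᶠ? part v))

  -- A permutation rather than the matching itself, so that the colour forbidden at v is
  -- no likelier than a single colour at u.
  edge-permutation : ∀ u v → Σ (Permutation′ K) (λ π → Extends π (M C u v))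
  edge-permutation u v = matching⇒permutation (record { functional = match₁ C u v ; injective = match₂ C u v })

  π : Fin n → Fin n → Permutation′ K
  π u v = proj₁ (edge-permutation u v)

  π-extends : ∀ u v → Extends (π u v) (M C u v)
  π-extends u v = proj₂ (edge-permutation u v)

  forbidden : (Fin n → Fin K) → Fin K → Fin n → Fin K
  forbidden f s v with earlierNeighbour? v
  ... | yes (u , _) = π u v ⟨$⟩ʳ f u
  ... | no  _       = s

  forbidden-blocks : ∀ f s {u v b} → part u <ᶠ part v → M C u v (f u) b ≡ true → b ≡ forbidden f s v
  forbidden-blocks f s {u} {v} {b} u<v Mub with earlierNeighbour? v
  ... | yes (u₀ , vu₀ , u₀<v) = subst (λ w → b ≡ π w v ⟨$⟩ʳ f w) (sym u₀≡u) (sym (π-extends u v Mub))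
    where
    u₀≡u : u₀ ≡ u
    u₀≡u = one-earlier v u₀ u vu₀ (trans (Graph.sym G v u) (edge C u v _ _ Mub)) u₀<v u<v
  ... | no none = contradiction (u , trans (Graph.sym G v u) (edge C u v _ _ Mub) , u<v) none

  prob-forbidden : ∀ {D : Weighted (Fin n → Fin K)} → IsProbability D → ∀ v →
                   (∀ u → part u <ᶠ part v → ∀ c → r ≤ prob D (λ f → f u ≟ c)) → ∀ a →
                   prob (D ⊗ U) (λ ω → forbidden (proj₁ ω) (proj₂ ω) v ≟ a) ≤ r
  prob-forbidden {D} pD v covered a with earlierNeighbour? v
  ... | yes (u , _ , u<v) = begin
    expect (D ⊗ U) (λ ω → 𝟙 (π u v ⟨$⟩ʳ proj₁ ω u ≟ a))          ≡⟨ expect-⊗ D U _ ⟩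
    expect D (λ f → expect U (const (𝟙 (π u v ⟨$⟩ʳ f u ≟ a))))   ≡⟨ expect-cong D (λ f → expect-const pU _) ⟩
    expect D (λ f → 𝟙 (π u v ⟨$⟩ʳ f u ≟ a))                      ≡⟨ expect-cong D (λ f → 𝟙-⟨$⟩ʳ-≟ (π u v) (f u) a) ⟩
    prob D (λ f → f u ≟ π u v ⟨$⟩ˡ a)                            ≤⟨ prob≤1/suc pD (λ f → f u) (covered u u<v) _ ⟩
    r                                                            ∎
    where open ≤-Reasoning
  ... | no _ = begin
    expect (D ⊗ U) (λ ω → 𝟙 (proj₂ ω ≟ a))   ≡⟨ expect-⊗ D U _ ⟩
    expect D (λ _ → prob U (_≟ a))           ≡⟨ expect-cong D (λ _ → prob-uniform (suc k) a) ⟩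
    expect D (const r)                       ≡⟨ expect-const pD r ⟩
    r                                        ∎
    where open ≤-Reasoning

  module Step {i} (i<m : i ℕ.< m) (P : PartialPacking C (Below i)) where
    open PartialPacking P

    j : Fin m
    j = fromℕ< i<m

    New : Fin n → Set
    New v = part v ≡ j

    old-or-new : ∀ {v} → Below (suc i) v → Below i v ⊎ New v
    old-or-new {v} v<i+1 with ℕ.m<1+n⇒m<n∨m≡n v<i+1
    ... | inj₁ v<i = inj₁ v<i
    ... | inj₂ v≡i = inj₂ (toℕ-injective (trans v≡i (sym (toℕ-fromℕ< i<m))))

    old<new : ∀ {u v} → Below i u → New v → part u <ᶠ part v
    old<new {u} u<i pv = subst (toℕ (part u) ℕ.<_) (sym (trans (cong toℕ pv) (toℕ-fromℕ< i<m))) u<i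

    glue : (Fin n → Fin K) → (Σ (Fin n) New → Fin K) → Fin n → Fin K
    glue f g v with part v ≟ j
    ... | yes p = g (v , p)
    ... | no  _ = f v

    glue-old : ∀ f g {v} → Below i v → glue f g v ≡ f v
    glue-old f g {v} v<i with part v ≟ j
    ... | yes p = contradiction (old<new v<i p) (<ᶠ-irrefl refl)
    ... | no  _ = refl

    glue-new : ∀ f g {v} (p : New v) → glue f g v ≡ g (v , p)
    glue-new f g {v} p with part v ≟ j
    ... | yes p′ = cong (λ q → g (v , q)) (Decidable⇒UIP.≡-irrelevant _≟_ p′ p)
    ... | no ¬p  = contradiction p ¬p

    Ω : Weighted ((Fin n → Fin K) × Fin K)
    Ω = dist ⊗ U

    avoiding : ∀ ω → AvoidingPacking (restrict C New) (λ x → forbidden (proj₁ ω) (proj₂ ω) (proj₁ x))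
    avoiding ω = avoidingPacking (good j) (restrict C New) (λ x → forbidden (proj₁ ω) (proj₂ ω) (proj₁ x))

    module E ω = AvoidingPacking (avoiding ω)

    next : Weighted (Fin n → Fin K)
    next = bind Ω (λ ω → push (glue (proj₁ ω)) (E.dist ω))

    prob-next : ∀ v a → prob next (λ h → h v ≟ a) ≡ expect Ω (λ ω → expect (E.dist ω) (λ g → 𝟙 (glue (proj₁ ω) g v ≟ a)))
    prob-next v a = trans (expect-bind Ω _ _) (expect-cong Ω (λ ω → expect-push (glue (proj₁ ω)) (E.dist ω) _))

    old-new-independent : ∀ {f s g} → Avoids (λ x → forbidden f s (proj₁ x)) g →
                          ∀ {u v} → Below i u → (p : New v) → M C u v (f u) (g (v , p)) ≡ false
    old-new-independent {f} {s} avoids u<i p =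
      Bool.¬-not (λ M≡true → avoids (_ , p) (forbidden-blocks f s (old<new u<i p) M≡true))

    glue-independent : ∀ {f s g} → IndependentOn C (Below i) f →
                       IndepTransversal (restrict C New) g → Avoids (λ x → forbidden f s (proj₁ x)) g →
                       IndependentOn C (Below (suc i)) (glue f g)
    glue-independent {f} {s} {g} ind-f ind-g avoids u v u<i+1 v<i+1 with old-or-new u<i+1 | old-or-new v<i+1
    ... | inj₁ u<i | inj₁ v<i rewrite glue-old f g u<i | glue-old f g v<i = ind-f u v u<i v<i
    ... | inj₂ pu  | inj₂ pv  rewrite glue-new f g pu  | glue-new f g pv  = ind-g (u , pu) (v , pv)
    ... | inj₁ u<i | inj₂ pv  rewrite glue-old f g u<i | glue-new f g pv  = old-new-independent avoids u<i pv
    ... | inj₂ pu  | inj₁ v<i rewrite glue-new f g pu  | glue-old f g v<i = trans (symM C u v _ _) (old-new-independent avoids v<i pu)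

    next-covers : ∀ v a → Below (suc i) v → r ≤ prob next (λ h → h v ≟ a)
    next-covers v a v<i+1 with old-or-new v<i+1
    ... | inj₁ v<i = begin
      r                                                                       ≤⟨ covers v a v<i ⟩
      prob dist (λ f → f v ≟ a)                                               ≡⟨ expect-cong dist (λ f → expect-const pU _) ⟨
      expect dist (λ f → expect U (const (𝟙 (f v ≟ a))))                      ≡⟨ expect-⊗ dist U _ ⟨
      expect Ω (λ ω → 𝟙 (proj₁ ω v ≟ a))                                      ≡⟨ expect-cong Ω old-mass ⟨
      expect Ω (λ ω → expect (E.dist ω) (λ g → 𝟙 (glue (proj₁ ω) g v ≟ a)))   ≡⟨ prob-next v a ⟨
      prob next (λ h → h v ≟ a)                                               ∎
      where
      open ≤-Reasoning
      old-mass : ∀ ω → expect (E.dist ω) (λ g → 𝟙 (glue (proj₁ ω) g v ≟ a)) ≡ 𝟙 (proj₁ ω v ≟ a)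
      old-mass ω = trans (expect-cong (E.dist ω) (λ g → cong (λ c → 𝟙 (c ≟ a)) (glue-old (proj₁ ω) g v<i)))
                         (expect-const (E.isProbability ω) _)
    ... | inj₂ pv = subst (r ≤_) (sym (trans (prob-next v a) (expect-cong Ω new-mass)))
      (mixture-covers (⊗-isProbability isProbability pU) avoiding (v , pv) a
        (prob-forbidden isProbability v (λ u u<v c → covers u c (earlier⇒old u<v)) a))
      where
      new-mass : ∀ ω → expect (E.dist ω) (λ g → 𝟙 (glue (proj₁ ω) g v ≟ a)) ≡ prob (E.dist ω) (λ g → g (v , pv) ≟ a)
      new-mass ω = expect-cong (E.dist ω) (λ g → cong (λ c → 𝟙 (c ≟ a)) (glue-new (proj₁ ω) g pv))
      earlier⇒old : ∀ {u} → part u <ᶠ part v → Below i u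
      earlier⇒old {u} u<v = subst (toℕ (part u) ℕ.<_) (trans (cong toℕ pv) (toℕ-fromℕ< i<m)) u<v

    packing : PartialPacking C (Below (suc i))
    packing = record
      { dist          = next
      ; isProbability = bind-isProbability (⊗-isProbability isProbability pU) (λ ω → push-isProbability (glue (proj₁ ω)) (E.isProbability ω))
      ; independent   = All-bind (λ {ω} ind-f → All-push (λ (ind-g , avoids) → glue-independent ind-f ind-g avoids) (E.admissible ω))
                                 (All-⊗ U independent)
      ; covers        = next-covers
      }

  emptyPacking : PartialPacking C (Below 0)
  emptyPacking = record
    { dist          = (1ℚ , const zero) ∷ []
    ; isProbability = record { nonNegWeights = nonNegative⁻¹ 1ℚ ∷ [] ; total = trans (+-identityʳ _) (*-identityʳ 1ℚ) }
    ; independent   = (λ _ _ ()) ∷ []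
    ; covers        = λ _ _ ()
    }

  packingBelow : ∀ i → i ℕ.≤ m → PartialPacking C (Below i)
  packingBelow zero    _   = emptyPacking
  packingBelow (suc i) i<m = Step.packing i<m (packingBelow i (ℕ.<⇒≤ i<m))

  fractionalPacking : FractionalPacking C
  fractionalPacking = toFractionalPacking (packingBelow m ℕ.≤-refl) (toℕ<n ∘ part)

Good-layered : ∀ {n m} (G : Graph (Fin n)) (part : Fin n → Fin m) →
               (∀ v u w → adj G v u ≡ true → adj G v w ≡ true → part u <ᶠ part v → part w <ᶠ part v → u ≡ w) →
               ∀ {k} → (∀ j → Good (induced G (λ v → part v ≡ j)) (suc k)) → Good G (suc (suc k))
Good-layered G part one-earlier good C = Layered.fractionalPacking G part one-earlier good C

lemma4p2 : (n : ℕ) (G : Graph (Fin n)) (t : ℕ) → IsWidth G t →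
             (k : ℕ) → IsChiFrac G k → k ℕ.≤ suc t
lemma4p2 n G zero    (() , _)
lemma4p2 n G (suc t) (_ , (m , part , parts , one-earlier) , _) k (_ , minimal) =
  ℕ.≮⇒≥ λ t+1<k → minimal (suc (suc t)) t+1<k (Good-layered G part one-earlier part-good)
  where
  part-good : ∀ j → Good (induced G (λ v → part v ≡ j)) (suc t)
  part-good j with parts j
  ... | _ , (good , _) , kⱼ≤t = Good-mono kⱼ≤t good
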